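{- Let $\Gamma$ be an LDDG with parameters $(v,k,\lambda_1,\lambda_2,m,n)$ and let $\theta$ be an automorphism of order $2$ of $\Gamma$. Define a graph $\Gamma_\theta$ on the same vertex set as $\Gamma$ by declaring two (possibly equal) vertices $x$ and $y$ adjacent in $\Gamma_\theta$ if and only if $x^\theta$ and $y$ are adjacent in $\Gamma$. Then: (1) $\Gamma_\theta$ is an LDDG with the same parameters as $\Gamma$; (2) if $N$ denotes the number of loops of $\Gamma$, $A_1$ the number of vertices $x$ without a loop in $\Gamma$ for which $x^\theta$ is adjacent to $x$ in $\Gamma$, and $A_2$ the number of vertices $y$ with a loop in $\Gamma$ for which $y^\theta$ is not adjacent to $y$ in $\Gamma$, then the number of loops in $\Gamma_\theta$ equals $N + A_1 - A_2$.
   Context: Graphs here are finite, undirected, without multiple edges, but loops are allowed: a vertex may be adjacent to itself (it then has a loop). For a vertex $x$, $\Gamma(x)$ is the set of vertices adjacent to $x$ (containing $x$ iff $x$ has a loop), and the degree of $x$ is $|\Gamma(x)|$. Common neighbours of $x,y$ are the elements of $\Gamma(x)\cap\Gamma(y)$. A $k$-regular graph on $v$ vertices is an LDDG with parameters $(v,k,\lambda_1,\lambda_2,m,n)$ if its vertex set can be partitioned into $m$ classes of size $n$ such that any two distinct vertices of the same class have exactly $\lambda_1$ common neighbours and any two vertices of different classes have exactly $\lambda_2$ common neighbours. An automorphism is a permutation of the vertices preserving adjacency (including loops); order 2 means $\theta^2=\mathrm{id}\neq\theta$. -}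

module Defs where

open import Data.Nat using (ℕ; zero; suc; _+_)
open import Data.Fin using (Fin; zero; suc; _≟_)
open import Relation.Nullary.Decidable using (⌊_⌋)
open import Data.Bool using (Bool; true; false; _∧_; not)
open import Data.Product using (Σ; _×_; ∃-syntax)
open import Relation.Binary.PropositionalEquality using (_≡_; _≢_)
open import Data.Fin.Permutation using (Permutation′; _⟨$⟩ʳ_)

count : ∀ {v} → (Fin v → Bool) → ℕ
count {zero} p = 0
count {suc v} p with p zero
... | true  = suc (count (λ i → p (suc i)))
... | false = count (λ i → p (suc i))

-- A graph on vertex set Fin v: symmetric boolean adjacency; adj x x = true means a loop.
Adj : ℕ → Set
Adj v = Fin v → Fin v → Bool

IsGraph : ∀ {v} → Adj v → Set
IsGraph adj = ∀ x y → adj x y ≡ adj y x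

degree : ∀ {v} → Adj v → Fin v → ℕ
degree adj x = count (adj x)

commonNbrs : ∀ {v} → Adj v → Fin v → Fin v → ℕ
commonNbrs adj x y = count (λ z → adj x z ∧ adj y z)

IsRegular : ∀ {v} → Adj v → ℕ → Set
IsRegular adj k = ∀ x → degree adj x ≡ k

IsPartition : ∀ {v} (m n : ℕ) → (Fin v → Fin m) → Set
IsPartition {v} m n cls = ∀ (c : Fin m) → count {v} (λ x → ⌊ cls x ≟ c ⌋) ≡ n

IsLDDG : ∀ {v} → Adj v → (k λ₁ λ₂ m n : ℕ) → Set
IsLDDG {v} adj k λ₁ λ₂ m n =
  IsGraph adj × IsRegular adj k ×
  (Σ (Fin v → Fin m) λ cls → IsPartition m n cls ×
     (∀ x y → x ≢ y → cls x ≡ cls y → commonNbrs adj x y ≡ λ₁) ×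
     (∀ x y → cls x ≢ cls y → commonNbrs adj x y ≡ λ₂))

IsAutomorphism : ∀ {v} → Adj v → Permutation′ v → Set
IsAutomorphism adj θ = ∀ x y → adj (θ ⟨$⟩ʳ x) (θ ⟨$⟩ʳ y) ≡ adj x y

HasOrder2 : ∀ {v} → Permutation′ v → Set
HasOrder2 θ = (∀ x → θ ⟨$⟩ʳ (θ ⟨$⟩ʳ x) ≡ x) × (∃[ x ] θ ⟨$⟩ʳ x ≢ x)

twist : ∀ {v} → Adj v → Permutation′ v → Adj v
twist adj θ x y = adj (θ ⟨$⟩ʳ x) y

loops : ∀ {v} → Adj v → ℕ
loops adj = count (λ x → adj x x)

{-# OPTIONS --safe #-}
module Submission where

-- Reindexing by the automorphism θ turns the common neighbours of x and y in
-- Γ_θ, namely Γ(x^θ) ∩ Γ(y^θ), into the image of Γ(x) ∩ Γ(y) under θ, so all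
-- counting parameters are preserved; θ² = id is needed only for Γ_θ to be
-- symmetric. The loop identity is |B| + |A ∖ B| = |A ∪ B| = |A| + |B ∖ A| for
-- the loops A of Γ and the loops B of Γ_θ.

open import Defs
open import Data.Nat using (ℕ; zero; suc; _+_)
open import Data.Nat.Properties using (+-0-commutativeMonoid; +-suc)
open import Data.Bool using (Bool; true; false; _∧_; _∨_; not)
open import Data.Bool.Properties using (∨-comm; ∧-comm)
open import Data.Product using (_×_; _,_)
open import Data.Fin as Fin using (Fin)
open import Data.Fin.Permutation using (Permutation′; _⟨$⟩ʳ_)
open import Function using (_∘_)
open import Relation.Binary.PropositionalEquality
  using (_≡_; refl; sym; trans; cong; cong₂; module ≡-Reasoning)
open import Algebra.Properties.CommutativeMonoid.Sum +-0-commutativeMonoid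
  using (sum; sum-cong-≗; sum-permute)

indicator : Bool → ℕ
indicator true  = 1
indicator false = 0

count≡sum-indicator : ∀ {v} (p : Fin v → Bool) → count p ≡ sum (indicator ∘ p)
count≡sum-indicator {zero}  p = refl
count≡sum-indicator {suc v} p with p Fin.zero
... | true  = cong suc (count≡sum-indicator (p ∘ Fin.suc))
... | false = count≡sum-indicator (p ∘ Fin.suc)

count-cong : ∀ {v} {p q : Fin v → Bool} → (∀ x → p x ≡ q x) → count p ≡ count q
count-cong {p = p} {q} p≗q = begin
  count p                ≡⟨ count≡sum-indicator p ⟩
  sum (indicator ∘ p)    ≡⟨ sum-cong-≗ (cong indicator ∘ p≗q) ⟩
  sum (indicator ∘ q)    ≡⟨ count≡sum-indicator q ⟨
  count q                ∎
  where open ≡-Reasoning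

count-permute : ∀ {v} (p : Fin v → Bool) (θ : Permutation′ v) →
                count p ≡ count (λ x → p (θ ⟨$⟩ʳ x))
count-permute p θ = begin
  count p                                  ≡⟨ count≡sum-indicator p ⟩
  sum (indicator ∘ p)                      ≡⟨ sum-permute (indicator ∘ p) θ ⟩
  sum (λ x → indicator (p (θ ⟨$⟩ʳ x)))     ≡⟨ count≡sum-indicator (λ x → p (θ ⟨$⟩ʳ x)) ⟨
  count (λ x → p (θ ⟨$⟩ʳ x))               ∎
  where open ≡-Reasoning

count-∨ : ∀ {v} (a b : Fin v → Bool) →
          count (λ x → a x ∨ b x) ≡ count a + count (λ x → not (a x) ∧ b x)
count-∨ {zero}  a b = refl
count-∨ {suc v} a b with a Fin.zero | b Fin.zero | count-∨ (a ∘ Fin.suc) (b ∘ Fin.suc)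
... | true  | _     | ih = cong suc ih
... | false | true  | ih = trans (cong suc ih) (sym (+-suc _ _))
... | false | false | ih = ih

count-+-difference-comm : ∀ {v} (a b : Fin v → Bool) →
  count b + count (λ x → a x ∧ not (b x)) ≡ count a + count (λ x → not (a x) ∧ b x)
count-+-difference-comm a b = begin
  count b + count (λ x → a x ∧ not (b x))   ≡⟨ cong (count b +_) (count-cong (λ x → ∧-comm (a x) (not (b x)))) ⟩
  count b + count (λ x → not (b x) ∧ a x)   ≡⟨ count-∨ b a ⟨
  count (λ x → b x ∨ a x)                   ≡⟨ count-cong (λ x → ∨-comm (b x) (a x)) ⟩
  count (λ x → a x ∨ b x)                   ≡⟨ count-∨ a b ⟩
  count a + count (λ x → not (a x) ∧ b x)   ∎
  where open ≡-Reasoning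

module _ {v} {adj : Adj v} {θ : Permutation′ v} (θ-aut : IsAutomorphism adj θ) where

  twist-isGraph : IsGraph adj → (∀ x → θ ⟨$⟩ʳ (θ ⟨$⟩ʳ x) ≡ x) → IsGraph (twist adj θ)
  twist-isGraph adj-sym θ-invol x y = begin
    adj (θ ⟨$⟩ʳ x) y                        ≡⟨ θ-aut (θ ⟨$⟩ʳ x) y ⟨
    adj (θ ⟨$⟩ʳ (θ ⟨$⟩ʳ x)) (θ ⟨$⟩ʳ y)      ≡⟨ cong (λ z → adj z (θ ⟨$⟩ʳ y)) (θ-invol x) ⟩
    adj x (θ ⟨$⟩ʳ y)                        ≡⟨ adj-sym x (θ ⟨$⟩ʳ y) ⟩
    adj (θ ⟨$⟩ʳ y) x                        ∎
    where open ≡-Reasoning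

  twist-commonNbrs : ∀ x y → commonNbrs (twist adj θ) x y ≡ commonNbrs adj x y
  twist-commonNbrs x y = begin
    count (λ z → adj (θ ⟨$⟩ʳ x) z ∧ adj (θ ⟨$⟩ʳ y) z)
      ≡⟨ count-permute _ θ ⟩
    count (λ z → adj (θ ⟨$⟩ʳ x) (θ ⟨$⟩ʳ z) ∧ adj (θ ⟨$⟩ʳ y) (θ ⟨$⟩ʳ z))
      ≡⟨ count-cong (λ z → cong₂ _∧_ (θ-aut x z) (θ-aut y z)) ⟩
    count (λ z → adj x z ∧ adj y z)
      ∎
    where open ≡-Reasoning

  twist-isLDDG : ∀ {k λ₁ λ₂ m n} → (∀ x → θ ⟨$⟩ʳ (θ ⟨$⟩ʳ x) ≡ x) →
                 IsLDDG adj k λ₁ λ₂ m n → IsLDDG (twist adj θ) k λ₁ λ₂ m n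
  twist-isLDDG θ-invol (adj-sym , regular , cls , partition , same-class , other-class) =
    twist-isGraph adj-sym θ-invol ,
    regular ∘ (θ ⟨$⟩ʳ_) ,
    cls , partition ,
    (λ x y x≢y same → trans (twist-commonNbrs x y) (same-class x y x≢y same)) ,
    (λ x y other → trans (twist-commonNbrs x y) (other-class x y other))

theorem3p28 : ∀ {v} (adj : Adj v) (k λ₁ λ₂ m n : ℕ) (θ : Permutation′ v) →
    IsLDDG adj k λ₁ λ₂ m n → IsAutomorphism adj θ → HasOrder2 θ →
    IsLDDG (twist adj θ) k λ₁ λ₂ m n ×
    (loops (twist adj θ) + count (λ y → adj y y ∧ not (adj (θ ⟨$⟩ʳ y) y))
      ≡ loops adj + count (λ x → not (adj x x) ∧ adj (θ ⟨$⟩ʳ x) x))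
theorem3p28 adj k λ₁ λ₂ m n θ lddg θ-aut (θ-invol , _) =
  twist-isLDDG {adj = adj} {θ = θ} θ-aut θ-invol lddg ,
  count-+-difference-comm (λ x → adj x x) (λ x → adj (θ ⟨$⟩ʳ x) x)
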